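{- Let $G=(V,E)$ be a temporal graph, $s\in V$, $t_s$ real, and let $T$ be the DFS tree produced by DFS-v1 or DFS-v2 from $s$ starting at $t_s$. Then $T$ has at most $|E(t_s)|+1$ nodes (vertex occurrences) and at most $|E(t_s)|+1$ edges.
   Context: A temporal graph is $G=(V,E)$ with $V$ a finite vertex set and $E$ a finite set of temporal edges $(u,v,t)$, $u\neq v$, $t$ real; distinct temporal edges from $u$ to $v$ have distinct times. $E(t_s)=\{(u,v,t)\in E: t\ge t_s\}$. Temporal DFS from $s$ with starting time $t_s$: keep $\sigma(x)$ for every vertex, initially $\infty$; build a rooted tree $T$ whose nodes are occurrences of vertices (a vertex may occur several times). Visit $s$: set $\sigma(s)=t_s$, create the root (an occurrence of $s$), make it current. Repeat: (a) Let $u$ be the current occurrence's vertex. DFS-v1: for each out-neighbor $v$ of $u$ let $E_{u,v}$ be the set of not-yet-traversed edges $(u,v,t)\in E$ with $\sigma(u)\le t$; if some $E_{u,v}\neq\emptyset$, choose such $v$, traverse the edge of $E_{u,v}$ of minimum time and go to (b). DFS-v2: let $E_u$ be the set of not-yet-traversed edges $(u,v,t)\in E$ leaving $u$ with $\sigma(u)\le t$; if $E_u\neq\emptyset$, traverse an edge of $E_u$ of maximum time and go to (b). In either version, if no edge is available: terminate if the current occurrence is the root, otherwise backtrack to the parent occurrence and repeat (a). (b) After traversing $(u,v,t)$: if $\sigma(v)>t$, set $\sigma(v)=t$, create a new occurrence of $v$ as a child of the current occurrence (the edge $(u,v,t)$ is a tree edge, and the edges of $T$ are exactly the tree edges), make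 it current, and go to (a); otherwise repeat (a). -}

module Defs where

open import Level using (0ℓ)
open import Data.Nat using (ℕ; zero; suc; _+_)
open import Data.Fin using (Fin; _≟_)
open import Data.List using (List; []; _∷_; length; _++_; [_])
open import Data.Maybe using (Maybe; just; nothing)
open import Data.Product using (_×_; _,_; Σ; ∃)
open import Data.Sum using (_⊎_)
open import Relation.Nullary using (¬_; yes; no)
open import Relation.Binary using (Rel; IsStrictTotalOrder; Tri; tri<; tri≈; tri>)
open import Relation.Binary.PropositionalEquality using (_≡_; _≢_)
open import Data.List.Membership.Propositional using (_∈_; _∉_)

record Edge (T : Set) (n : ℕ) : Set where
  constructor edge
  field
    src  : Fin n
    dst  : Fin n
    time : T
open Edge public

data T∞ (T : Set) : Set where
  fin : T → T∞ T
  ∞   : T∞ T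

data Version : Set where
  v1 v2 : Version

-- Times range over an arbitrary strict total order (ℝ being an instance).
module TG {T : Set} {_<_ : Rel T 0ℓ} (sto : IsStrictTotalOrder _≡_ _<_) (n : ℕ) where

  open IsStrictTotalOrder sto using (compare)

  _≤_ : T → T → Set
  a ≤ b = (a < b) ⊎ (a ≡ b)

  data _≤∞_ : T∞ T → T → Set where
    fin≤ : ∀ {a b} → a ≤ b → fin a ≤∞ b

  data _<∞_ : T → T∞ T → Set where
    <fin : ∀ {a b} → a < b → a <∞ fin b
    <inf : ∀ {a} → a <∞ ∞

  -- |E(t_s)| : number of temporal edges with time ≥ t_s
  countFrom : T → List (Edge T n) → ℕ
  countFrom ts [] = zero
  countFrom ts (e ∷ es) with compare (time e) ts
  ... | tri< _ _ _ = countFrom ts es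
  ... | tri≈ _ _ _ = suc (countFrom ts es)
  ... | tri> _ _ _ = suc (countFrom ts es)

  -- A node (vertex occurrence) of the DFS tree T: its vertex, and (unless it
  -- is the root) the index of its parent occurrence and its tree edge.
  record Node : Set where
    constructor node
    field
      vertex : Fin n
      parent : Maybe (ℕ × Edge T n)
  open Node public

  -- Edges of the tree T: (parent index, child index, temporal edge).
  treeEdgesFrom : ℕ → List Node → List (ℕ × ℕ × Edge T n)
  treeEdgesFrom i [] = []
  treeEdgesFrom i (node v nothing ∷ ns) = treeEdgesFrom (suc i) ns
  treeEdgesFrom i (node v (just (p , e)) ∷ ns) = (p , i , e) ∷ treeEdgesFrom (suc i) ns

  treeEdges : List Node → List (ℕ × ℕ × Edge T n)
  treeEdges = treeEdgesFrom zero

  record State : Set where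
    constructor state
    field
      traversed : List (Edge T n)
      σ         : Fin n → T∞ T
      tree      : List Node                 -- nodes of T, indexed by creation order
      path      : List (ℕ × Fin n)          -- occurrences from current (head) up to root
  open State public

  data Config : Set where
    running : State → Config
    done    : State → Config

  update : Fin n → T∞ T → (Fin n → T∞ T) → (Fin n → T∞ T)
  update v x σ w with w ≟ v
  ... | yes _ = x
  ... | no  _ = σ w

  initσ : Fin n → T → Fin n → T∞ T
  initσ s ts w with w ≟ s
  ... | yes _ = fin ts
  ... | no  _ = ∞

  initial : Fin n → T → Config
  initial s ts = running (state [] (initσ s ts) [ node s nothing ] [ (0 , s) ])

  module _ (E : List (Edge T n)) where

    Available : State → Fin n → Edge T n → Set
    Available st u e = (e ∈ E) × (src e ≡ u) × (e ∉ traversed st) × (σ st u ≤∞ time e)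

    Chosen : Version → State → Fin n → Edge T n → Set
    -- DFS-v1: some v with E_{u,v} ≠ ∅ (v = dst e), and e has minimum time in E_{u,v}
    Chosen v1 st u e = Available st u e ×
      (∀ e' → Available st u e' → dst e' ≡ dst e → time e ≤ time e')
    Chosen v2 st u e = Available st u e ×
      (∀ e' → Available st u e' → time e' ≤ time e)

    data Step (ver : Version) : Config → Config → Set where
      traverse-new : ∀ {tr σ tr' i u p e} →
        Chosen ver (state tr σ tr' ((i , u) ∷ p)) u e →
        time e <∞ σ (dst e) →
        Step ver (running (state tr σ tr' ((i , u) ∷ p)))
                 (running (state (e ∷ tr) (update (dst e) (fin (time e)) σ)
                                 (tr' ++ [ node (dst e) (just (i , e)) ])
                                 ((length tr' , dst e) ∷ (i , u) ∷ p)))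
      traverse-old : ∀ {tr σ tr' i u p e} →
        Chosen ver (state tr σ tr' ((i , u) ∷ p)) u e →
        ¬ (time e <∞ σ (dst e)) →
        Step ver (running (state tr σ tr' ((i , u) ∷ p)))
                 (running (state (e ∷ tr) σ tr' ((i , u) ∷ p)))
      backtrack : ∀ {tr σ tr' i u j w p} →
        (∀ e → ¬ Available (state tr σ tr' ((i , u) ∷ (j , w) ∷ p)) u e) →
        Step ver (running (state tr σ tr' ((i , u) ∷ (j , w) ∷ p)))
                 (running (state tr σ tr' ((j , w) ∷ p)))
      terminate : ∀ {tr σ tr' i u} →
        (∀ e → ¬ Available (state tr σ tr' [ (i , u) ]) u e) →
        Step ver (running (state tr σ tr' [ (i , u) ]))
                 (done (state tr σ tr' [ (i , u) ]))

module Submission where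

-- A new node of the DFS tree is created only in step (b), right after an
-- edge has been traversed, and every traversal adds a fresh edge to the list of
-- traversed edges.  Hence, along any run, #nodes ≤ 1 + #traversed edges.  The
-- traversed edges are pairwise distinct edges of E, and each of them has time
-- ≥ t_s, because it was available at a vertex u with t_s ≤ σ(u) ≤ t (σ never
-- drops below t_s: it starts at t_s or ∞ and is only lowered to the time of an
-- edge just traversed).  So they form a duplicate-free sublist of E(t_s) and
-- #traversed ≤ |E(t_s)|.  Every tree edge belongs to a non-root node, so the
-- edge bound follows from the node bound.

open import Defs
open import Level using (0ℓ)
open import Data.Nat using (ℕ; suc; _+_; _≤_; z≤n; s≤s)
open import Data.Nat.Properties using (≤-trans; m≤n⇒m≤1+n; +-comm)
import Data.Fin as Fin
open import Data.Fin using (Fin)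
open import Data.List using (List; []; _∷_; length; _++_; [_]; filter)
open import Data.List.Properties using (length-++; length-removeAt′)
open import Data.List.Relation.Unary.All using (All; []; _∷_)
import Data.List.Relation.Unary.All as All
open import Data.List.Relation.Unary.Any using (here; there; index; _─_)
open import Data.List.Relation.Unary.AllPairs using ([]; _∷_)
open import Data.List.Relation.Unary.Unique.Propositional using (Unique)
open import Data.List.Membership.Propositional using (_∈_)
open import Data.List.Membership.Propositional.Properties using (∈-filter⁺)
open import Data.Maybe using (just; nothing)
open import Data.Product using (_×_; _,_; proj₁)
open import Data.Sum using (inj₁; inj₂)
open import Data.Unit using (⊤; tt)
open import Data.Empty using (⊥-elim)
open import Relation.Nullary using (yes; no)
open import Relation.Unary using (Decidable)
open import Relation.Binary using (Rel; IsStrictTotalOrder; tri<; tri≈; tri>)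
import Relation.Binary.Construct.StrictToNonStrict as NonStrict
open import Relation.Binary.PropositionalEquality
  using (_≡_; _≢_; refl; sym; trans; cong; subst; isEquivalence)
open import Relation.Binary.Construct.Closure.ReflexiveTransitive using (Star; ε; _◅_)

module Counting {A : Set} where

  ∈-─⁺ : ∀ {x y : A} {ys} (p : x ∈ ys) → y ∈ ys → x ≢ y → y ∈ (ys ─ p)
  ∈-─⁺ (here refl) (here refl) x≢y = ⊥-elim (x≢y refl)
  ∈-─⁺ (here _)    (there q)   _   = q
  ∈-─⁺ (there p)   (here refl) _   = here refl
  ∈-─⁺ (there p)   (there q)   x≢y = there (∈-─⁺ p q x≢y)

  -- A duplicate-free list all of whose elements occur in ys is no longer
  -- than ys (the list form of "an injection into a finite set"): remove the
  -- head x from ys and recurse on the tail, which avoids x.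
  unique-⊆-length : ∀ {xs ys : List A} → Unique xs → All (_∈ ys) xs →
                    length xs ≤ length ys
  unique-⊆-length {[]}          _          _              = z≤n
  unique-⊆-length {x ∷ xs} {ys} (x∉xs ∷ u) (x∈ys ∷ xs⊆ys) =
    subst (suc (length xs) ≤_) (sym (length-removeAt′ ys (index x∈ys)))
          (s≤s (unique-⊆-length u xs⊆ys─x))
    where
    xs⊆ys─x : All (_∈ (ys ─ x∈ys)) xs
    xs⊆ys─x = All.zipWith (λ (y∈ys , x≢y) → ∈-─⁺ x∈ys y∈ys x≢y) (xs⊆ys , x∉xs)

  length-snoc : ∀ (xs : List A) x → length (xs ++ [ x ]) ≡ suc (length xs)
  length-snoc xs x = trans (length-++ xs) (+-comm (length xs) 1)

module Proof {T : Set} {_<_ : Rel T 0ℓ} (sto : IsStrictTotalOrder _≡_ _<_) (n : ℕ) where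
  open TG sto n renaming (_≤_ to _≤ₜ_)
  open IsStrictTotalOrder sto using (compare; <-resp-≈) renaming (trans to <-trans)
  open Counting

  ≤ₜ-trans : ∀ {a b c} → a ≤ₜ b → b ≤ₜ c → a ≤ₜ c
  ≤ₜ-trans = NonStrict.trans _≡_ _<_ isEquivalence <-resp-≈ <-trans

  Later : T → Edge T n → Set
  Later ts e = ts ≤ₜ time e

  -- Decided by the same comparison that countFrom performs.
  later? : ∀ ts → Decidable (Later ts)
  later? ts e with compare (time e) ts
  ... | tri< _ e≢ts ts≮e = no λ { (inj₁ ts<e) → ts≮e ts<e ; (inj₂ ts≡e) → e≢ts (sym ts≡e) }
  ... | tri≈ _ e≡ts _    = yes (inj₂ (sym e≡ts))
  ... | tri> _ _ ts<e    = yes (inj₁ ts<e)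

  countFrom-filter : ∀ ts E → countFrom ts E ≡ length (filter (later? ts) E)
  countFrom-filter ts [] = refl
  countFrom-filter ts (e ∷ E) with compare (time e) ts
  ... | tri< _ _ _ = countFrom-filter ts E
  ... | tri≈ _ _ _ = cong suc (countFrom-filter ts E)
  ... | tri> _ _ _ = cong suc (countFrom-filter ts E)

  distinct-later-≤-countFrom : ∀ ts E {xs} → Unique xs → All (_∈ E) xs →
                               All (Later ts) xs → length xs ≤ countFrom ts E
  distinct-later-≤-countFrom ts E {xs} u xs⊆E later =
    subst (_ ≤_) (sym (countFrom-filter ts E)) (unique-⊆-length u xs⊆Eₜₛ)
    where
    xs⊆Eₜₛ : All (_∈ filter (later? ts) E) xs
    xs⊆Eₜₛ = All.zipWith (λ (e∈E , l) → ∈-filter⁺ (later? ts) e∈E l) (xs⊆E , later)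

  AtLeast : T → T∞ T → Set
  AtLeast ts (fin a) = ts ≤ₜ a
  AtLeast ts ∞       = ⊤

  available-later : ∀ {ts x t} → AtLeast ts x → x ≤∞ t → ts ≤ₜ t
  available-later ts≤x (fin≤ x≤t) = ≤ₜ-trans ts≤x x≤t

  chosen⇒available : ∀ {E} ver {st u e} → Chosen E ver st u e → Available E st u e
  chosen⇒available v1 = proj₁
  chosen⇒available v2 = proj₁

  record Invariant (E : List (Edge T n)) (ts : T) (st : State) : Set where
    field
      nodes≤traversed : length (tree st) ≤ suc (length (traversed st))
      distinct        : Unique (traversed st)
      traversed⊆E     : All (_∈ E) (traversed st)
      traversedLater  : All (Later ts) (traversed st)
      σ≥ts            : ∀ w → AtLeast ts (σ st w)
  open Invariant

  stateOf : Config → State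
  stateOf (running st) = st
  stateOf (done st)    = st

  initial-invariant : ∀ E s ts → Invariant E ts (stateOf (initial s ts))
  initial-invariant E s ts = record
    { nodes≤traversed = s≤s z≤n ; distinct = [] ; traversed⊆E = [] ; traversedLater = []
    ; σ≥ts = initσ≥ts }
    where
    initσ≥ts : ∀ w → AtLeast ts (initσ s ts w)
    initσ≥ts w with w Fin.≟ s
    ... | yes _ = inj₂ refl
    ... | no  _ = tt

  path-irrelevant : ∀ {E ts tr σ₀ tr' p p'} →
    Invariant E ts (state tr σ₀ tr' p) → Invariant E ts (state tr σ₀ tr' p')
  path-irrelevant inv = record
    { nodes≤traversed = nodes≤traversed inv ; distinct = distinct inv
    ; traversed⊆E = traversed⊆E inv ; traversedLater = traversedLater inv ; σ≥ts = σ≥ts inv }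

  traverse-invariant : ∀ {E ts tr σ₀ tr' p u e} → Available E (state tr σ₀ tr' p) u e →
    Invariant E ts (state tr σ₀ tr' p) →
    Unique (e ∷ tr) × All (_∈ E) (e ∷ tr) × All (Later ts) (e ∷ tr)
  traverse-invariant {tr = tr} (e∈E , _ , e∉tr , σu≤e) inv =
      (All.tabulate (λ e∈tr e≡ → e∉tr (subst (_∈ tr) (sym e≡) e∈tr)) ∷ distinct inv)
    , (e∈E ∷ traversed⊆E inv)
    , (available-later (σ≥ts inv _) σu≤e ∷ traversedLater inv)

  -- Every DFS step preserves the invariant; only traverse-new adds a node.
  step-invariant : ∀ {E ver ts c c'} → Step E ver c c' →
                   Invariant E ts (stateOf c) → Invariant E ts (stateOf c')
  step-invariant {ver = ver} {ts} (traverse-new {tr} {σ₀} {tr'} {e = e} ch _) inv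
    with traverse-invariant (chosen⇒available ver ch) inv
  ... | uniq , ⊆E , later = record
    { nodes≤traversed = subst (_≤ suc (suc (length tr))) (sym (length-snoc tr' _))
                              (s≤s (nodes≤traversed inv))
    ; distinct = uniq ; traversed⊆E = ⊆E ; traversedLater = later
    ; σ≥ts = updated≥ts }
    where
    -- σ(dst e) is lowered to time e, which is ≥ t_s.
    updated≥ts : ∀ w → AtLeast ts (update (dst e) (fin (time e)) σ₀ w)
    updated≥ts w with w Fin.≟ dst e
    ... | yes _ = All.head later
    ... | no  _ = σ≥ts inv w
  step-invariant {ver = ver} (traverse-old ch _) inv
    with traverse-invariant (chosen⇒available ver ch) inv
  ... | uniq , ⊆E , later = record
    { nodes≤traversed = m≤n⇒m≤1+n (nodes≤traversed inv)
    ; distinct = uniq ; traversed⊆E = ⊆E ; traversedLater = later ; σ≥ts = σ≥ts inv }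
  step-invariant (backtrack _) inv = path-irrelevant inv
  step-invariant (terminate _) inv = path-irrelevant inv

  run-invariant : ∀ {E ver ts c c'} → Star (Step E ver) c c' →
                  Invariant E ts (stateOf c) → Invariant E ts (stateOf c')
  run-invariant ε         inv = inv
  run-invariant (s ◅ run) inv = run-invariant run (step-invariant s inv)

  -- Each tree edge is the parent link of a distinct node.
  treeEdges≤nodes : ∀ i ns → length (treeEdgesFrom i ns) ≤ length ns
  treeEdges≤nodes i []                    = z≤n
  treeEdges≤nodes i (node _ nothing ∷ ns)  = m≤n⇒m≤1+n (treeEdges≤nodes (suc i) ns)
  treeEdges≤nodes i (node _ (just _) ∷ ns) = s≤s (treeEdges≤nodes (suc i) ns)

  nodes≤count+1 : ∀ E s ts ver st → Star (Step E ver) (initial s ts) (done st) →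
                  length (tree st) ≤ countFrom ts E + 1
  nodes≤count+1 E s ts ver st run =
    subst (length (tree st) ≤_) (+-comm 1 (countFrom ts E))
      (≤-trans (nodes≤traversed inv)
               (s≤s (distinct-later-≤-countFrom ts E (distinct inv) (traversed⊆E inv)
                                                   (traversedLater inv))))
    where
    inv : Invariant E ts st
    inv = run-invariant run (initial-invariant E s ts)

lemma2 : {T : Set} {_<_ : Rel T 0ℓ} (sto : IsStrictTotalOrder _≡_ _<_) (n : ℕ)
    (E : List (Edge T n)) → Unique E → All (λ e → src e ≢ dst e) E →
    (s : Fin n) (ts : T) (ver : Version) (st : TG.State sto n) →
    Star (TG.Step sto n E ver) (TG.initial sto n s ts) (TG.done st) →
    (length (TG.State.tree st) ≤ TG.countFrom sto n ts E + 1)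
    × (length (TG.treeEdges sto n (TG.State.tree st)) ≤ TG.countFrom sto n ts E + 1)
lemma2 sto n E _ _ s ts ver st run =
  nodes≤bound , ≤-trans (treeEdges≤nodes 0 (TG.State.tree st)) nodes≤bound
  where
  open Proof sto n
  nodes≤bound : length (TG.State.tree st) ≤ TG.countFrom sto n ts E + 1
  nodes≤bound = nodes≤count+1 E s ts ver st run
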